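{- For every $n$ there exists a directed graph $G$ with $\Theta(n)$ vertices such that every $1$-faulty-degree-tolerant connectivity preserver $H\subseteq G$ of $G$ has $\Omega(n^2)$ edges.
   Context: A subgraph $H$ of a directed graph $G$ ($V(H)=V(G)$, $E(H)\subseteq E(G)$) is a $k$-faulty-degree-tolerant connectivity preserver of $G$ if for every pair of vertices $u,v$ and every edge set $F\subseteq E(G)$ such that $|F\cap(\delta^+(x)\cup\delta^-(x))|\le k$ for every vertex $x$ (where $\delta^+(x),\delta^-(x)$ are the out- and in-edges of $x$), $u,v$ are strongly connected in $G-F$ if and only if they are strongly connected in $H-F$. -}

module Defs where

open import Data.Nat using (ℕ)
open import Data.Bool using (Bool; true; false; _∧_; _∨_; not; T)
open import Data.Fin using (Fin)
open import Data.Fin.Properties using () renaming (_≟_ to _≟ᶠ_)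
open import Data.List using (List; length; filterᵇ; cartesianProduct; allFin)
open import Data.Product using (_×_; _,_)
open import Relation.Nullary.Decidable using (⌊_⌋)
open import Relation.Binary.Construct.Closure.ReflexiveTransitive using (Star)
open import Function.Bundles using (_⇔_)

Digraph : ℕ → Set
Digraph N = Fin N → Fin N → Bool

allPairs : (N : ℕ) → List (Fin N × Fin N)
allPairs N = cartesianProduct (allFin N) (allFin N)

edgeCount : {N : ℕ} → Digraph N → ℕ
edgeCount {N} G = length (filterᵇ (λ { (a , b) → G a b }) (allPairs N))

_⊆ᴱ_ : {N : ℕ} → Digraph N → Digraph N → Set
_⊆ᴱ_ {N} H G = (u v : Fin N) → T (H u v) → T (G u v)

_=ᵥ_ : {N : ℕ} → Fin N → Fin N → Bool
x =ᵥ y = ⌊ _≟ᶠ_ x y ⌋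

incidentCount : {N : ℕ} → Digraph N → Fin N → ℕ
incidentCount {N} F x =
  length (filterᵇ (λ { (a , b) → F a b ∧ ((a =ᵥ x) ∨ (b =ᵥ x)) }) (allPairs N))

_∖ᴱ_ : {N : ℕ} → Digraph N → Digraph N → Digraph N
(G ∖ᴱ F) u v = G u v ∧ not (F u v)

Edge : {N : ℕ} → Digraph N → Fin N → Fin N → Set
Edge G u v = T (G u v)

Reach : {N : ℕ} → Digraph N → Fin N → Fin N → Set
Reach G = Star (Edge G)

StronglyConnected : {N : ℕ} → Digraph N → Fin N → Fin N → Set
StronglyConnected G u v = Reach G u v × Reach G v u

IsFDTPreserver : {N : ℕ} → ℕ → Digraph N → Digraph N → Set
IsFDTPreserver {N} k G H =
  H ⊆ᴱ G ×
  ((F : Digraph N) → F ⊆ᴱ G →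
   ((x : Fin N) → incidentCount F x Data.Nat.≤ k) →
   (u v : Fin N) →
   StronglyConnected (G ∖ᴱ F) u v ⇔ StronglyConnected (H ∖ᴱ F) u v)

{-# OPTIONS --safe #-}
-- G consists of three layers a_k, b_k, c_k (k < n) with all edges a_i → b_j, the
-- matching b_k → c_k and all edges c_k → a_i.  The fault set F_j, the matching
-- without b_j → c_j, meets every vertex at most once, and a_i, b_j stay strongly
-- connected in G − F_j via a_i → b_j → c_j → a_i.  If H lacks a_i → b_j, then no
-- edge of H − F_j leaves {a_i} ∪ {b_k | k ≠ j}, so b_j is unreachable from a_i.
-- Hence every preserver contains all n² edges a_i → b_j, while G has 3n vertices.
module Submission where

open import Defs
open import Data.Nat using (ℕ; _≤_; _*_; suc)
open import Data.Product using (Σ; _×_; ∃)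

open import Data.Bool using (Bool; true; false; _∧_; _∨_; not; T)
open import Data.Bool.Properties using (T-∧; T-∨; T?)
open import Data.Empty using (⊥-elim)
open import Data.Fin using (Fin; combine; remQuot)
open import Data.Fin.Patterns using (0F; 1F; 2F)
open import Data.Fin.Properties using (remQuot-combine; combine-remQuot)
  renaming (_≟_ to _≟ᶠ_)
open import Data.List using (List; []; _∷_; [_]; _++_; length; map; tabulate; filterᵇ; cartesianProduct)
open import Data.List.Properties using (length-++; length-map; length-tabulate; length-removeAt′)
open import Data.List.Membership.Propositional using (_∈_; _─_)
open import Data.List.Membership.Propositional.Properties
  using (∈-filter⁺; ∈-filter⁻; ∈-cartesianProduct⁺; ∈-cartesianProduct⁻; ∈-tabulate⁻; ∈-allFin)
open import Data.List.Relation.Binary.Subset.Propositional using (_⊆_)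
open import Data.List.Relation.Unary.All as All using ()
open import Data.List.Relation.Unary.Any using (here; there; index)
open import Data.List.Relation.Unary.AllPairs using (_∷_)
open import Data.List.Relation.Unary.Unique.Propositional using (Unique; [])
open import Data.List.Relation.Unary.Unique.Propositional.Properties
  using (cartesianProduct⁺; tabulate⁺; allFin⁺; filter⁺)
open import Data.Nat using (_+_; z≤n; s≤s)
open import Data.Nat.Properties using (≤-refl; ≤-trans; m≤n*m; m≤n⇒m≤o*n; module ≤-Reasoning)
open import Data.Product using (_,_; proj₁; proj₂; uncurry)
open import Data.Sum using (_⊎_; inj₁; inj₂)
import Data.Sum as Sum
open import Function using (_∘_; id)
open import Function.Bundles using (Equivalence)
open import Function.Definitions using (Injective)
open import Relation.Nullary using (¬_; yes; no)
open import Relation.Nullary.Decidable using (toWitness; isYes≗does; dec-true; decidable-stable)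
open import Relation.Binary.PropositionalEquality
  using (_≡_; _≢_; refl; sym; trans; cong; cong₂; subst; subst₂; module ≡-Reasoning)
open import Relation.Binary.Construct.Closure.ReflexiveTransitive using (ε; _◅_; fold)

module _ {A : Set} where

  ∈-─ : ∀ {x y} {ys : List A} (x∈ys : x ∈ ys) → y ∈ ys → y ≢ x → y ∈ ys ─ x∈ys
  ∈-─ (here refl)  (here refl)  y≢x = ⊥-elim (y≢x refl)
  ∈-─ (here refl)  (there y∈ys) _   = y∈ys
  ∈-─ (there x∈ys) (here refl)  _   = here refl
  ∈-─ (there x∈ys) (there y∈ys) y≢x = there (∈-─ x∈ys y∈ys y≢x)

  Unique-⊆⇒length≤ : ∀ {xs ys : List A} → Unique xs → xs ⊆ ys → length xs ≤ length ys
  Unique-⊆⇒length≤ []                          _     = z≤n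
  Unique-⊆⇒length≤ {x ∷ xs} {ys} (x≢xs ∷ !xs) xs⊆ys = begin
    suc (length xs)          ≤⟨ s≤s (Unique-⊆⇒length≤ !xs xs⊆ys─x) ⟩
    suc (length (ys ─ x∈ys)) ≡⟨ length-removeAt′ ys (index x∈ys) ⟨
    length ys                ∎
    where
    open ≤-Reasoning
    x∈ys : x ∈ ys
    x∈ys = xs⊆ys (here refl)
    xs⊆ys─x : xs ⊆ ys ─ x∈ys
    xs⊆ys─x y∈xs = ∈-─ x∈ys (xs⊆ys (there y∈xs)) (All.lookup x≢xs y∈xs ∘ sym)

  filterᵇ-length≤1 : (p : A → Bool) (e : A) {xs : List A} → Unique xs →
    (∀ {y} → T (p y) → y ≡ e) → length (filterᵇ p xs) ≤ 1
  filterᵇ-length≤1 p e {xs} !xs only-e = Unique-⊆⇒length≤ (filter⁺ (T? ∘ p) !xs) filter⊆[e]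
    where
    filter⊆[e] : filterᵇ p xs ⊆ [ e ]
    filter⊆[e] y∈ = here (only-e (proj₂ (∈-filter⁻ (T? ∘ p) {xs = xs} y∈)))

length-cartesianProduct : ∀ {A B : Set} (xs : List A) (ys : List B) →
  length (cartesianProduct xs ys) ≡ length xs * length ys
length-cartesianProduct []       ys = refl
length-cartesianProduct (x ∷ xs) ys = begin
  length (map (x ,_) ys ++ cartesianProduct xs ys)         ≡⟨ length-++ (map (x ,_) ys) ⟩
  length (map (x ,_) ys) + length (cartesianProduct xs ys)
    ≡⟨ cong₂ _+_ (length-map (x ,_) ys) (length-cartesianProduct xs ys) ⟩
  length ys + length xs * length ys                        ∎
  where open ≡-Reasoning

=ᵥ⇒≡ : ∀ {m} {x y : Fin m} → T (x =ᵥ y) → x ≡ y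
=ᵥ⇒≡ = toWitness

=ᵥ-refl : ∀ {m} (x : Fin m) → (x =ᵥ x) ≡ true
=ᵥ-refl x = trans (isYes≗does (x ≟ᶠ x)) (dec-true (x ≟ᶠ x) refl)

module _ {N : ℕ} where

  allPairs-Unique : Unique (allPairs N)
  allPairs-Unique = cartesianProduct⁺ (allFin⁺ N) (allFin⁺ N)

  ∈-allPairs : (u v : Fin N) → (u , v) ∈ allPairs N
  ∈-allPairs u v = ∈-cartesianProduct⁺ (∈-allFin u) (∈-allFin v)

  biclique⇒*≤edgeCount : ∀ {m k} (H : Digraph N) {f : Fin m → Fin N} {g : Fin k → Fin N} →
    Injective _≡_ _≡_ f → Injective _≡_ _≡_ g → (∀ i j → Edge H (f i) (g j)) →
    m * k ≤ edgeCount H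
  biclique⇒*≤edgeCount {m} {k} H {f} {g} f-inj g-inj complete = begin
    m * k                                               ≡⟨ cong₂ _*_ (length-tabulate f) (length-tabulate g) ⟨
    length (tabulate f) * length (tabulate g)           ≡⟨ length-cartesianProduct (tabulate f) (tabulate g) ⟨
    length (cartesianProduct (tabulate f) (tabulate g)) ≤⟨ Unique-⊆⇒length≤ biclique-Unique biclique⊆edges ⟩
    edgeCount H                                         ∎
    where
    open ≤-Reasoning
    biclique-Unique : Unique (cartesianProduct (tabulate f) (tabulate g))
    biclique-Unique = cartesianProduct⁺ (tabulate⁺ f-inj) (tabulate⁺ g-inj)
    biclique⊆edges : cartesianProduct (tabulate f) (tabulate g) ⊆ filterᵇ (uncurry H) (allPairs N)
    biclique⊆edges uv∈
      with u∈ , v∈ ← ∈-cartesianProduct⁻ (tabulate f) (tabulate g) uv∈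
      with i , refl ← ∈-tabulate⁻ u∈
         | j , refl ← ∈-tabulate⁻ v∈
      = ∈-filter⁺ (T? ∘ uncurry H) (∈-allPairs (f i) (g j)) (complete i j)

  incidentCount≤1 : (F : Digraph N) (x : Fin N) (e : Fin N × Fin N) →
    (∀ {u v} → Edge F u v → u ≡ x ⊎ v ≡ x → (u , v) ≡ e) → incidentCount F x ≤ 1
  incidentCount≤1 F x e only-e = filterᵇ-length≤1 _ e allPairs-Unique incident⇒e
    where
    incident⇒e : ∀ {uv} → T (F (proj₁ uv) (proj₂ uv) ∧ ((proj₁ uv =ᵥ x) ∨ (proj₂ uv =ᵥ x))) → uv ≡ e
    incident⇒e {u , v} uv-incident with uv∈F , incident ← Equivalence.to T-∧ uv-incident
      = only-e uv∈F (Sum.map =ᵥ⇒≡ =ᵥ⇒≡ (Equivalence.to (T-∨ {u =ᵥ x}) incident))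

module Construction (n : ℕ) where

  Slot : Set
  Slot = Fin 3 × Fin n

  vertex : Slot → Fin (3 * n)
  vertex = uncurry combine

  slot : Fin (3 * n) → Slot
  slot = remQuot n

  slot-vertex : ∀ p → slot (vertex p) ≡ p
  slot-vertex (l , k) = remQuot-combine l k

  vertex-injective : Injective _≡_ _≡_ vertex
  vertex-injective {p} {q} eq = begin
    p               ≡⟨ slot-vertex p ⟨
    slot (vertex p) ≡⟨ cong slot eq ⟩
    slot (vertex q) ≡⟨ slot-vertex q ⟩
    q               ∎
    where open ≡-Reasoning

  layer-injective : ∀ l → Injective _≡_ _≡_ (λ k → vertex (l , k))
  layer-injective l = cong proj₂ ∘ vertex-injective {l , _} {l , _}

  slot≡⇒≡vertex : ∀ {x p} → slot x ≡ p → x ≡ vertex p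
  slot≡⇒≡vertex {x} refl = sym (combine-remQuot n x)

  onSlots : (Slot → Slot → Bool) → Digraph (3 * n)
  onSlots R u v = R (slot u) (slot v)

  onSlots-edge : ∀ R {p q} → T (R p q) → Edge (onSlots R) (vertex p) (vertex q)
  onSlots-edge R {p} {q} rewrite slot-vertex p | slot-vertex q = id

  a b c : Fin n → Fin (3 * n)
  a i = vertex (0F , i)
  b j = vertex (1F , j)
  c j = vertex (2F , j)

  arc : Slot → Slot → Bool
  arc (0F , _)  (1F , _)  = true
  arc (1F , j₁) (2F , j₂) = j₁ =ᵥ j₂
  arc (2F , _)  (0F , _)  = true
  arc _         _         = false

  matchingExcept : Fin n → Slot → Slot → Bool
  matchingExcept j (1F , j₁) (2F , j₂) = (j₁ =ᵥ j₂) ∧ not (j₁ =ᵥ j)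
  matchingExcept j _         _         = false

  G : Digraph (3 * n)
  G = onSlots arc

  F : Fin n → Digraph (3 * n)
  F j = onSlots (matchingExcept j)

  matchingExcept-inv : ∀ j p q → T (matchingExcept j p q) → ∃ λ k → p ≡ (1F , k) × q ≡ (2F , k)
  matchingExcept-inv j (1F , j₁) (2F , j₂) t
    with refl ← =ᵥ⇒≡ {x = j₁} (proj₁ (Equivalence.to T-∧ t)) = j₁ , refl , refl

  matchingExcept⇒arc : ∀ j p q → T (matchingExcept j p q) → T (arc p q)
  matchingExcept⇒arc j p q t
    with k , refl , refl ← matchingExcept-inv j p q t = proj₁ (Equivalence.to T-∧ t)

  F⊆G : ∀ j → F j ⊆ᴱ G
  F⊆G j u v = matchingExcept⇒arc j (slot u) (slot v)

  position : Fin (3 * n) → Fin n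
  position = proj₂ ∘ slot

  F-edge-at : ∀ j x {u v} → Edge (F j) u v → u ≡ x ⊎ v ≡ x → (u , v) ≡ (b (position x) , c (position x))
  F-edge-at j x {u} {v} uv∈F incident
    with k , su , sv ← matchingExcept-inv j (slot u) (slot v) uv∈F = begin
      (u , v)                           ≡⟨ cong₂ _,_ (slot≡⇒≡vertex su) (slot≡⇒≡vertex sv) ⟩
      (b k , c k)                       ≡⟨ cong (λ k → b k , c k) (incident⇒position≡ incident su sv) ⟨
      (b (position x) , c (position x)) ∎
    where
    open ≡-Reasoning
    incident⇒position≡ : ∀ {u v x k l l′} → u ≡ x ⊎ v ≡ x →
      slot u ≡ (l , k) → slot v ≡ (l′ , k) → position x ≡ k
    incident⇒position≡ (inj₁ refl) su _  = cong proj₂ su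
    incident⇒position≡ (inj₂ refl) _  sv = cong proj₂ sv

  F-incident≤1 : ∀ j x → incidentCount (F j) x ≤ 1
  F-incident≤1 j x = incidentCount≤1 (F j) x _ (F-edge-at j x)

  cycle : ∀ i j → StronglyConnected (G ∖ᴱ F j) (a i) (b j)
  cycle i j = a→b ◅ ε , b→c ◅ c→a ◅ ε
    where
    arc∖F : Slot → Slot → Bool
    arc∖F p q = arc p q ∧ not (matchingExcept j p q)
    a→b : Edge (G ∖ᴱ F j) (a i) (b j)
    a→b = onSlots-edge arc∖F {0F , i} {1F , j} _
    b→c : Edge (G ∖ᴱ F j) (b j) (c j)
    b→c = onSlots-edge arc∖F {1F , j} {2F , j} (subst (λ t → T (t ∧ not (t ∧ not t))) (sym (=ᵥ-refl j)) _)
    c→a : Edge (G ∖ᴱ F j) (c j) (a i)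
    c→a = onSlots-edge arc∖F {2F , j} {0F , i} _

  trap : Fin n → Fin n → Slot → Bool
  trap i j (0F , i′) = i′ =ᵥ i
  trap i j (1F , j′) = not (j′ =ᵥ j)
  trap i j (2F , _)  = false

  trap-closed : ∀ i j p q → T (trap i j p) → T (arc p q) → T (not (matchingExcept j p q)) →
    (p , q) ≢ ((0F , i) , (1F , j)) → T (trap i j q)
  trap-closed i j (0F , i′) (1F , j′) i′≡i _ _ not-ab with j′ ≟ᶠ j
  ... | yes refl with refl ← =ᵥ⇒≡ {x = i′} i′≡i = ⊥-elim (not-ab refl)
  ... | no _ = _
  trap-closed i j (1F , j₁) (2F , j₂) j₁≢j j₁≡j₂ kept with j₁ =ᵥ j₂ | j₁ =ᵥ j
  ... | true | false = ⊥-elim kept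
  trap-closed i j (0F , _) (0F , _) _ () _ _
  trap-closed i j (0F , _) (2F , _) _ () _ _
  trap-closed i j (1F , _) (0F , _) _ () _ _
  trap-closed i j (1F , _) (1F , _) _ () _ _
  trap-closed i j (2F , _) _        () _ _ _

  module _ {H : Digraph (3 * n)} (H⊆G : H ⊆ᴱ G) (i j : Fin n) (ab∉H : ¬ Edge H (a i) (b j)) where

    InTrap : Fin (3 * n) → Set
    InTrap x = T (trap i j (slot x))

    H∖F-trap-closed : ∀ {x y} → Edge (H ∖ᴱ F j) x y → InTrap x → InTrap y
    H∖F-trap-closed {x} {y} xy∈H∖F x∈trap
      with xy∈H , xy∉F ← Equivalence.to T-∧ xy∈H∖F
      = trap-closed i j (slot x) (slot y) x∈trap (H⊆G x y xy∈H) xy∉F xy≢ab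
      where
      xy≢ab : (slot x , slot y) ≢ ((0F , i) , (1F , j))
      xy≢ab eq = ab∉H (subst₂ (Edge H) (slot≡⇒≡vertex (cong proj₁ eq)) (slot≡⇒≡vertex (cong proj₂ eq)) xy∈H)

    a↛b : ¬ Reach (H ∖ᴱ F j) (a i) (b j)
    a↛b a⇝b = b∉trap (fold (λ x y → InTrap x → InTrap y) (λ e ⇝ → ⇝ ∘ H∖F-trap-closed e) id a⇝b a∈trap)
      where
      a∈trap : InTrap (a i)
      a∈trap = subst T (cong (trap i j) (sym (slot-vertex (0F , i)))) (subst T (sym (=ᵥ-refl i)) _)
      b∉trap : ¬ InTrap (b j)
      b∉trap b∈trap = subst (T ∘ not) (=ᵥ-refl j) (subst T (cong (trap i j) (slot-vertex (1F , j))) b∈trap)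

  preserver⇒a→b : ∀ {H} → IsFDTPreserver 1 G H → ∀ i j → Edge H (a i) (b j)
  preserver⇒a→b (H⊆G , preserves) i j = decidable-stable (T? _) λ ab∉H →
    a↛b H⊆G i j ab∉H (proj₁ (Equivalence.to (preserves (F j) (F⊆G j) (F-incident≤1 j) (a i) (b j)) (cycle i j)))

  preserver-edgeCount : ∀ {H} → IsFDTPreserver 1 G H → n * n ≤ edgeCount H
  preserver-edgeCount {H} P = biclique⇒*≤edgeCount H
    (layer-injective 0F) (layer-injective 1F) (preserver⇒a→b P)

theoremB2 : Σ ℕ λ a → Σ ℕ λ c → Σ ℕ λ n₀ → (n : ℕ) → n₀ ≤ n →
    Σ ℕ λ N → Σ (Digraph N) λ G →
      (N ≤ suc a * n) × (n ≤ suc a * N) ×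
      ((H : Digraph N) → IsFDTPreserver 1 G H → n * n ≤ suc c * edgeCount H)
theoremB2 = 2 , 0 , 0 , λ n _ →
  3 * n , Construction.G n , ≤-refl , m≤n⇒m≤o*n 3 (m≤n*m n 3) ,
  λ H preserver → ≤-trans (Construction.preserver-edgeCount n preserver) (m≤n*m (edgeCount H) 1)
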